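{- Suppose that a $4$-cycle $C$ in a graph $G$ has two adjacent edges $e_1,e_2$ such that, for $i=1,2$, $e_i$ is contained in a triangle of $G$ that does not contain $e_{3-i}$. Then $C$ is contained in a copy of $F^-$ in $G$ for some $F\in\{F_0,F_1,K_4\}$. Moreover, in each case, adding the edge that forms a triangle with $e_1$ and $e_2$ completes this copy of $F^-$ to a copy of $F$.
   Context: $F_0$ is the graph on vertices $u_1,u_2,u_3,w_1,w_2,w_3$ with edges $u_1u_2,u_2u_3,u_1u_3$ and $w_3u_1,w_3u_2,w_2u_1,w_2u_3,w_1u_2,w_1u_3$ (a triangle with a further triangle attached to each of its edges); $F_0^-$ is $F_0$ with the edge $u_2u_3$ removed. $F_1$ is the graph on vertices $u_1,u_2,u_3,w,w_1$ with edges $u_1u_2,u_2u_3,u_1u_3,wu_1,wu_2,wu_3,w_1u_2,w_1u_3$ (a $K_4$ with a triangle attached to one edge); $F_1^-$ is $F_1$ with the edge $u_2u_3$ removed. $K_4^-$ is $K_4$ with one edge removed. -}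

module Defs where

open import Data.Nat using (ℕ)
open import Data.Fin using (Fin; zero; suc)
open import Data.Product using (_×_; _,_; Σ; ∃)
open import Data.Sum using (_⊎_)
open import Data.List using (List; []; _∷_)
open import Data.List.Membership.Propositional using (_∈_)
open import Relation.Binary.PropositionalEquality using (_≡_)
open import Relation.Nullary using (¬_)
open import Function.Definitions using (Injective)

record Graph (n : ℕ) : Set₁ where
  field
    Adj    : Fin n → Fin n → Set
    sym    : ∀ {u v} → Adj u v → Adj v u
    irrefl : ∀ {v} → ¬ Adj v v
open Graph public

SameEdge : ∀ {A : Set} → A → A → A → A → Set
SameEdge p q r s = (p ≡ r × q ≡ s) ⊎ (p ≡ s × q ≡ r)

-- A small pattern graph F on vertex set Fin size, with a distinguished edge
-- 'removed'.  'minusEdges' lists the edges of F⁻ (F with 'removed' deleted);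
-- the edges of F are 'removed' together with 'minusEdges'.
record Pattern : Set where
  field
    size       : ℕ
    minusEdges : List (Fin size × Fin size)
    removed    : Fin size × Fin size
open Pattern public

edgesOf : (F : Pattern) → List (Fin (size F) × Fin (size F))
edgesOf F = removed F ∷ minusEdges F

F₀ : Pattern
F₀ = record
  { size = 6
  ; minusEdges =
      (u1 , u2) ∷ (u1 , u3)
      ∷ (w3 , u1) ∷ (w3 , u2) ∷ (w2 , u1) ∷ (w2 , u3) ∷ (w1 , u2) ∷ (w1 , u3) ∷ []
  ; removed = (u2 , u3)
  }
  where
  u1 u2 u3 w1 w2 w3 : Fin 6
  u1 = zero
  u2 = suc zero
  u3 = suc (suc zero)
  w1 = suc (suc (suc zero))
  w2 = suc (suc (suc (suc zero)))
  w3 = suc (suc (suc (suc (suc zero))))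

F₁ : Pattern
F₁ = record
  { size = 5
  ; minusEdges =
      (u1 , u2) ∷ (u1 , u3)
      ∷ (w , u1) ∷ (w , u2) ∷ (w , u3) ∷ (w1 , u2) ∷ (w1 , u3) ∷ []
  ; removed = (u2 , u3)
  }
  where
  u1 u2 u3 w w1 : Fin 5
  u1 = zero
  u2 = suc zero
  u3 = suc (suc zero)
  w  = suc (suc (suc zero))
  w1 = suc (suc (suc (suc zero)))

K₄ : Pattern
K₄ = record
  { size = 4
  ; minusEdges =
      (v0 , v2) ∷ (v0 , v3) ∷ (v1 , v2) ∷ (v1 , v3) ∷ (v2 , v3) ∷ []
  ; removed = (v0 , v1)
  }
  where
  v0 v1 v2 v3 : Fin 4
  v0 = zero
  v1 = suc zero
  v2 = suc (suc zero)
  v3 = suc (suc (suc zero))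

data IsOneOf : Pattern → Set where
  isF₀ : IsOneOf F₀
  isF₁ : IsOneOf F₁
  isK₄ : IsOneOf K₄

record CopyMinus {n : ℕ} (G : Graph n) (F : Pattern) : Set where
  field
    φ        : Fin (size F) → Fin n
    φ-inj    : Injective _≡_ _≡_ φ
    φ-edges  : ∀ {u v} → (u , v) ∈ minusEdges F → Adj G (φ u) (φ v)
open CopyMinus public

EdgeInCopy : ∀ {n} {G : Graph n} {F : Pattern} → CopyMinus G F → Fin n → Fin n → Set
EdgeInCopy {F = F} c p q =
  Σ (Fin (size F) × Fin (size F)) λ e →
    e ∈ minusEdges F × SameEdge (φ c (Data.Product.proj₁ e)) (φ c (Data.Product.proj₂ e)) p q

FourCycle : ∀ {n} → Graph n → Fin n → Fin n → Fin n → Fin n → Set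
FourCycle G a b c d =
  (¬ a ≡ b) × (¬ a ≡ c) × (¬ a ≡ d) × (¬ b ≡ c) × (¬ b ≡ d) × (¬ c ≡ d)
  × Adj G a b × Adj G b c × Adj G c d × Adj G d a

-- The two triangles through e₁ = ab and e₂ = bc have apexes x and y, and the
-- configuration is decided by how x, y and d coincide.  If x or y equals d,
-- then bd is a chord of C and {a,b,c,d} spans K₄ minus ac.  If x = y ≠ d, then
-- x is adjacent to a, b and c, and with d (adjacent to a and c) this is F₁
-- minus ac.  If x, y, d are pairwise distinct, then triangles sit on ba, bc
-- and, via d, on ac, giving F₀ minus ac.  In every case the missing edge is ac.
module Submission where

open import Defs
open import Data.Nat using (ℕ)
open import Data.Fin using (Fin; _≟_)
open import Data.Product using (_×_; Σ; proj₁; proj₂; _,_)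
open import Data.Sum using (inj₁; inj₂)
open import Data.List.Relation.Unary.All as All using (All)
open import Data.List.Relation.Unary.Any using (here; there)
open import Data.Vec using (Vec; []; _∷_; lookup)
open import Data.Vec.Relation.Unary.All using ([]; _∷_)
open import Data.Vec.Relation.Unary.AllPairs using ([]; _∷_)
open import Data.Vec.Relation.Unary.Unique.Propositional using (Unique)
open import Data.Vec.Relation.Unary.Unique.Propositional.Properties using (lookup-injective)
open import Relation.Binary.PropositionalEquality using (_≡_; _≢_; refl; ≢-sym)
open import Relation.Nullary using (¬_; yes; no)

adj⇒≢ : ∀ {n} (G : Graph n) {u v} → Adj G u v → u ≢ v
adj⇒≢ G uv refl = irrefl G uv

PreservesMinusEdges : ∀ {n} → Graph n → (F : Pattern) → Vec (Fin n) (size F) → Set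
PreservesMinusEdges G F vs =
  All (λ e → Adj G (lookup vs (proj₁ e)) (lookup vs (proj₂ e))) (minusEdges F)

copyMinus : ∀ {n} (G : Graph n) (F : Pattern) (vs : Vec (Fin n) (size F)) →
  Unique vs → PreservesMinusEdges G F vs → CopyMinus G F
copyMinus G F vs distinct edges = record
  { φ       = lookup vs
  ; φ-inj   = lookup-injective distinct _ _
  ; φ-edges = All.lookup edges
  }

module _ {n : ℕ} (G : Graph n) where

  CompletedBy : ∀ {F} → CopyMinus G F → Fin n → Fin n → Set
  CompletedBy {F} cp p q = SameEdge (φ cp (proj₁ (removed F))) (φ cp (proj₂ (removed F))) p q

  InCompletableCopy : Fin n → Fin n → Fin n → Fin n → Set
  InCompletableCopy a b c d =
    Σ Pattern λ F → IsOneOf F × Σ (CopyMinus G F) λ cp →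
      EdgeInCopy cp a b × EdgeInCopy cp b c × EdgeInCopy cp c d × EdgeInCopy cp d a
      × CompletedBy cp a c

  chorded-inCompletableCopy : ∀ {a b c d} → FourCycle G a b c d → Adj G b d →
    InCompletableCopy a b c d
  chorded-inCompletableCopy {a} {b} {c} {d}
    (a≢b , a≢c , a≢d , b≢c , b≢d , c≢d , ab , bc , cd , da) bd =
    K₄ , isK₄ , cp
    , (_ , here refl , inj₁ (refl , refl))
    , (_ , there (there (here refl)) , inj₂ (refl , refl))
    , (_ , there (there (there (here refl))) , inj₁ (refl , refl))
    , (_ , there (here refl) , inj₂ (refl , refl))
    , inj₁ (refl , refl)
    where
    cp : CopyMinus G K₄
    cp = copyMinus G K₄ (a ∷ c ∷ b ∷ d ∷ [])
      ( (a≢c ∷ a≢b ∷ a≢d ∷ []) ∷ (≢-sym b≢c ∷ c≢d ∷ []) ∷ (b≢d ∷ []) ∷ [] ∷ [])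
      (ab All.∷ sym G da All.∷ sym G bc All.∷ cd All.∷ bd All.∷ All.[])

  apex-inCompletableCopy : ∀ {a b c d x} → FourCycle G a b c d →
    Adj G a x → Adj G b x → Adj G c x → x ≢ d → InCompletableCopy a b c d
  apex-inCompletableCopy {a} {b} {c} {d} {x}
    (a≢b , a≢c , a≢d , b≢c , b≢d , c≢d , ab , bc , cd , da) ax bx cx x≢d =
    F₁ , isF₁ , cp
    , (_ , here refl , inj₂ (refl , refl))
    , (_ , there (here refl) , inj₁ (refl , refl))
    , (_ , there (there (there (there (there (there (here refl)))))) , inj₂ (refl , refl))
    , (_ , there (there (there (there (there (here refl))))) , inj₁ (refl , refl))
    , inj₁ (refl , refl)
    where
    cp : CopyMinus G F₁
    cp = copyMinus G F₁ (b ∷ a ∷ c ∷ x ∷ d ∷ [])  -- as (u₁, u₂, u₃, w, w₁)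
      ( (≢-sym a≢b ∷ b≢c ∷ adj⇒≢ G bx ∷ b≢d ∷ [])
      ∷ (a≢c ∷ adj⇒≢ G ax ∷ a≢d ∷ [])
      ∷ (adj⇒≢ G cx ∷ c≢d ∷ [])
      ∷ (x≢d ∷ []) ∷ [] ∷ [])
      ( sym G ab All.∷ bc All.∷ sym G bx All.∷ sym G ax All.∷ sym G cx
        All.∷ da All.∷ sym G cd All.∷ All.[])

  twoApexes-inCompletableCopy : ∀ {a b c d x y} → FourCycle G a b c d →
    Adj G a x → Adj G b x → x ≢ c → Adj G b y → Adj G c y → y ≢ a →
    x ≢ d → y ≢ d → x ≢ y → InCompletableCopy a b c d
  twoApexes-inCompletableCopy {a} {b} {c} {d} {x} {y}
    (a≢b , a≢c , a≢d , b≢c , b≢d , c≢d , ab , bc , cd , da)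
    ax bx x≢c by cy y≢a x≢d y≢d x≢y =
    F₀ , isF₀ , cp
    , (_ , here refl , inj₂ (refl , refl))
    , (_ , there (here refl) , inj₁ (refl , refl))
    , (_ , there (there (there (there (there (there (there (here refl))))))) , inj₂ (refl , refl))
    , (_ , there (there (there (there (there (there (here refl)))))) , inj₁ (refl , refl))
    , inj₁ (refl , refl)
    where
    cp : CopyMinus G F₀
    cp = copyMinus G F₀ (b ∷ a ∷ c ∷ d ∷ y ∷ x ∷ [])  -- as (u₁, u₂, u₃, w₁, w₂, w₃)
      ( (≢-sym a≢b ∷ b≢c ∷ b≢d ∷ adj⇒≢ G by ∷ adj⇒≢ G bx ∷ [])
      ∷ (a≢c ∷ a≢d ∷ ≢-sym y≢a ∷ adj⇒≢ G ax ∷ [])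
      ∷ (c≢d ∷ adj⇒≢ G cy ∷ ≢-sym x≢c ∷ [])
      ∷ (≢-sym y≢d ∷ ≢-sym x≢d ∷ [])
      ∷ (≢-sym x≢y ∷ []) ∷ [] ∷ [])
      ( sym G ab All.∷ bc All.∷ sym G bx All.∷ sym G ax All.∷ sym G by
        All.∷ sym G cy All.∷ da All.∷ sym G cd All.∷ All.[])

lemma3p3 : {n : ℕ} (G : Graph n) (a b c d : Fin n) → FourCycle G a b c d →
    (x : Fin n) → Adj G a x → Adj G b x → ¬ x ≡ c →
    (y : Fin n) → Adj G b y → Adj G c y → ¬ y ≡ a →
    Σ Pattern λ F → IsOneOf F × Σ (CopyMinus G F) λ cp →
      EdgeInCopy cp a b × EdgeInCopy cp b c × EdgeInCopy cp c d × EdgeInCopy cp d a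
      × SameEdge (φ cp (proj₁ (removed F))) (φ cp (proj₂ (removed F))) a c
lemma3p3 G a b c d C x ax bx x≢c y by cy y≢a with x ≟ d | y ≟ d | x ≟ y
... | yes refl | _        | _        = chorded-inCompletableCopy G C bx
... | no _     | yes refl | _        = chorded-inCompletableCopy G C by
... | no x≢d   | no _     | yes refl = apex-inCompletableCopy G C ax bx cy x≢d
... | no x≢d   | no y≢d   | no x≢y   =
  twoApexes-inCompletableCopy G C ax bx x≢c by cy y≢a x≢d y≢d x≢y
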